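{- Let $n\ge1$, $d\ge0$, $L\ge0$ be integers with $L\le d/2$, let $S\subset[n]^\infty$ be a $d$-maximal set containing no $(L+1)$-ball, and let $w\in S$. Let $\ell\ge0$ and $0\le m\le k$ be integers, and let $t^{(m)}$ be a template that is regular with respect to $w$ and has weight $m$. Then \[ \bigl|S^{(\ell)}_k[t^{(m)}]\bigr|\le \mathrm{Sun}(d+n,\,2k-2m). \]
   Context: $[n]=\{1,\dots,n\}$, $[n]^\infty$ is the set of infinite sequences over $[n]$, $\mathrm{dist}(a,b)=|\{i:a_i\ne b_i\}|$, $\mathrm{diam}(S)=\sup_{a,b\in S}\mathrm{dist}(a,b)$. $S$ is $d$-maximal if $\mathrm{diam}(S)=d$ and $S$ is inclusion-maximal among subsets of $[n]^\infty$ of diameter $d$. $\mathrm{Ball}(a,r)=\{b:\mathrm{dist}(a,b)\le r\}$; $S$ contains an $r$-ball if $\mathrm{Ball}(a,r)\subset S$ for some $a$. $S^{(\ell)}=\{a\in S:\mathrm{Ball}(a,\ell)\subset S$ and there is no $b$ with $\mathrm{Ball}(a,\ell)\subset\mathrm{Ball}(b,\ell+1)\subset S\}$; $S_k=\{a\in S:\mathrm{dist}(w,a)=k\}$; $S^{(\ell)}_k=S^{(\ell)}\cap S_k$. A template is $t\in([n]\cup\{\star\})^\infty$; $a$ fits $t$ if $a_i=t_i$ whenever $t_i\ne\star$; $X[t]=\{a\in X:a\text{ fits }t\}$; $t$ is regular with respect to $w$ if $t_i\ne w_i$ for all $i$; the weight of $t$ is $|\{i:t_i\ne\star\}|$. For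 $p\ge1$, $j\ge0$, $\mathrm{Sun}(p,j)$ is the least integer $N$ such that every family of more than $N$ distinct $j$-element sets contains $p$ distinct sets whose pairwise intersections are all identical (so $\mathrm{Sun}(p,0)=1$ for $p\ge2$). -}

module Defs where

open import Data.Nat using (ℕ; suc; _≤_; _<_; _+_)
open import Data.Fin using (Fin)
open import Data.Maybe using (Maybe; just)
open import Data.List using (List; length)
open import Data.List.Relation.Unary.All using (All)
open import Data.List.Relation.Unary.Unique.Propositional using (Unique)
open import Data.List.Relation.Unary.AllPairs using (AllPairs)
open import Data.List.Membership.Propositional using (_∈_)
open import Data.Product using (Σ; ∃; _×_)
open import Relation.Binary.PropositionalEquality using (_≡_; _≢_)
open import Relation.Nullary using (¬_)
open import Function.Bundles using (_⇔_)

AtMost : (ℕ → Set) → ℕ → Set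
AtMost P r = (xs : List ℕ) → Unique xs → All P xs → length xs ≤ r

AtLeast : (ℕ → Set) → ℕ → Set
AtLeast P r = Σ (List ℕ) λ xs → Unique xs × All P xs × length xs ≡ r

Exactly : (ℕ → Set) → ℕ → Set
Exactly P r = AtMost P r × AtLeast P r

-- [n]^∞ as functions ℕ → Fin n

Seq : ℕ → Set
Seq n = ℕ → Fin n

Subset : ℕ → Set₁
Subset n = Seq n → Set

DistLE : ∀ {n} → Seq n → Seq n → ℕ → Set
DistLE a b r = AtMost (λ i → a i ≢ b i) r

DistGE : ∀ {n} → Seq n → Seq n → ℕ → Set
DistGE a b r = AtLeast (λ i → a i ≢ b i) r

DistEq : ∀ {n} → Seq n → Seq n → ℕ → Set
DistEq a b r = Exactly (λ i → a i ≢ b i) r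

-- diam(S) = d  (distances are naturals, so the sup equals d iff all
-- distances are ≤ d and some pair realises d)
Diam : ∀ {n} → Subset n → ℕ → Set
Diam S d = (∀ a b → S a → S b → DistLE a b d)
         × (Σ _ λ a → Σ _ λ b → S a × S b × DistGE a b d)

Maximal : ∀ {n} → Subset n → ℕ → Set₁
Maximal {n} S d = Diam S d
  × ((T : Subset n) → (∀ a → S a → T a) → Diam T d → ∀ a → T a → S a)

BallIn : ∀ {n} → Seq n → ℕ → Subset n → Set
BallIn a r S = ∀ b → DistLE a b r → S b

BallSub : ∀ {n} → Seq n → ℕ → Seq n → ℕ → Set
BallSub a r b r' = ∀ c → DistLE a c r → DistLE b c r'

ContainsBall : ∀ {n} → Subset n → ℕ → Set
ContainsBall S r = ∃ λ a → BallIn a r S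

Sℓ : ∀ {n} → Subset n → ℕ → Subset n
Sℓ S ℓ a = S a × BallIn a ℓ S
         × ¬ (∃ λ b → BallSub a ℓ b (suc ℓ) × BallIn b (suc ℓ) S)

Sk : ∀ {n} → Subset n → Seq n → ℕ → Subset n
Sk S w k a = S a × DistEq w a k

-- Templates: nothing = ⋆

Template : ℕ → Set
Template n = ℕ → Maybe (Fin n)

Fits : ∀ {n} → Seq n → Template n → Set
Fits a t = ∀ i c → t i ≡ just c → a i ≡ c

Restrict : ∀ {n} → Subset n → Template n → Subset n
Restrict X t a = X a × Fits a t

Regular : ∀ {n} → Template n → Seq n → Set
Regular t w = ∀ i c → t i ≡ just c → c ≢ w i

Weight : ∀ {n} → Template n → ℕ → Set
Weight t m = Exactly (λ i → ∃ λ c → t i ≡ just c) m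

-- Cardinality: |X| ≤ N  (every list of pairwise distinct elements has length ≤ N);
-- sequences are compared pointwise (no function extensionality).

CardLE : ∀ {n} → Subset n → ℕ → Set
CardLE {n} X N = (xs : List (Seq n)) → AllPairs (λ a b → ¬ (∀ i → a i ≡ b i)) xs
               → All X xs → length xs ≤ N

-- Sunflower numbers. Finite sets are duplicate-free lists of naturals,
-- compared extensionally.

SameSet : List ℕ → List ℕ → Set
SameSet A B = ∀ x → (x ∈ A) ⇔ (x ∈ B)

CommonCore : List (List ℕ) → Set
CommonCore Gs = Σ (List ℕ) λ core →
  AllPairs (λ A B → ∀ x → (x ∈ A × x ∈ B) ⇔ (x ∈ core)) Gs

SunProp : ℕ → ℕ → ℕ → Set
SunProp p j N = (Fs : List (List ℕ))
  → All (λ A → Unique A × length A ≡ j) Fs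
  → AllPairs (λ A B → ¬ SameSet A B) Fs
  → N < length Fs
  → Σ (List (List ℕ)) λ Gs → length Gs ≡ p × All (_∈ Fs) Gs
      × AllPairs (λ A B → ¬ SameSet A B) Gs × CommonCore Gs

IsSun : ℕ → ℕ → ℕ → Set
IsSun p j N = SunProp p j N × (∀ M → M < N → ¬ SunProp p j M)

{-# OPTIONS --safe #-}
module Submission where

-- Attach to each a ∈ S^(ℓ)_k[t] its footprint: the pairs (z, ⋆) and (z, a z) for the positions z off the
-- template where a differs from w. These 2k − 2m codes determine a, so more than Sun(d + n, 2k − 2m) points
-- would give a sunflower of n + d footprints. A core position lies in every petal and, by pigeonhole on the
-- n − 1 letters other than w z, carries the same letter in all of them; hence two distinct petals force a
-- petal a_i with a private position j. Resetting a_i at j to w j gives c with Ball(a_i, ℓ) ⊆ Ball(c, ℓ + 1).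
-- For s ∈ S some other petal a_h has s = w on all its private positions (else s would differ from a_i in
-- more than d places), and comparing with Ball(a_h, ℓ) ⊆ S gives dist(c, s) ≤ d − ℓ − 1. By maximality
-- Ball(c, ℓ + 1) ⊆ S, contradicting a_i ∈ S^(ℓ).

open import Defs
open import Level using (0ℓ)
open import Data.Empty using (⊥; ⊥-elim)
open import Data.Fin as Fin using (Fin; zero; suc; toℕ; cast; punchIn; punchOut)
import Data.Fin.Properties as Finₚ
open import Data.List using (List; []; _∷_; length; _++_; filter; map; lookup; tabulate; upTo; [_])
open import Data.List.Extrema.Nat using (max; xs≤max)
open import Data.List.Membership.Propositional using (_∈_; _∉_; find)
open import Data.List.Membership.Propositional.Properties
  using (∈-filter⁺; ∈-filter⁻; ∈-map⁺; ∈-map⁻; ∈-++⁺ˡ; ∈-++⁺ʳ; ∈-++⁻; ∈-∃++; ∈-lookup)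
open import Data.List.Properties using (length-++; length-map; length-upTo; length-tabulate)
open import Data.List.Relation.Binary.Subset.Propositional using (_⊆_)
open import Data.List.Relation.Unary.All as All using (All; []; _∷_)
import Data.List.Relation.Unary.All.Properties as Allₚ
open import Data.List.Relation.Unary.AllPairs as AllPairs using (AllPairs; []; _∷_)
import Data.List.Relation.Unary.AllPairs.Properties as AllPairsₚ
open import Data.List.Relation.Unary.Any using (here; there)
open import Data.List.Relation.Unary.Unique.Propositional using (Unique)
import Data.List.Relation.Unary.Unique.Propositional.Properties as Uniqueₚ
open import Data.Maybe using (just; nothing)
open import Data.Nat using (ℕ; zero; suc; _≤_; _<_; _+_; _*_; _∸_; z≤n; s≤s)
open import Data.Nat.DivMod using (_%_; [m+kn]%n≡m%n; m<n⇒m%n≡m)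
open import Data.Nat.Properties
open import Data.List.Membership.DecPropositional _≟_ using (_∈?_)
open import Data.Product using (Σ; ∃; ∃₂; _×_; _,_; proj₁; proj₂; swap)
open import Data.Sum using (_⊎_; inj₁; inj₂)
open import Function using (_∘_)
open import Function.Bundles using (_⇔_; mk⇔; Equivalence)
import Function.Properties.Equivalence as ⇔
open import Relation.Binary.Definitions using (Symmetric)
open import Relation.Binary.PropositionalEquality hiding ([_])
open import Relation.Nullary using (¬_; yes; no; ¬?; _×-dec_; contradiction)
open import Relation.Unary using (Pred; Decidable; ∁; _∩_)
open import Relation.Unary.Properties using (∁?)

private variable
  n q r r′ ℓ d : ℕ
  z : ℕ
  xs ys zs D : List ℕ
  a b s w : Seq n
  S : Subset n

module _ {A : Set} {P : Pred A 0ℓ} (P? : Decidable P) where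

  length-filter-∁ : ∀ xs → length (filter P? xs) + length (filter (∁? P?) xs) ≡ length xs
  length-filter-∁ [] = refl
  length-filter-∁ (x ∷ xs) with P? x
  ... | yes _ = cong suc (length-filter-∁ xs)
  ... | no _ = trans (+-suc _ _) (cong suc (length-filter-∁ xs))

Unique-++⁺ : ∀ {A : Set} {P Q : Pred A 0ℓ} {xs ys : List A} → Unique xs → Unique ys →
             All P xs → All Q ys → (∀ {x} → P x → Q x → ⊥) → Unique (xs ++ ys)
Unique-++⁺ uxs uys pxs qys separated =
  Uniqueₚ.++⁺ uxs uys λ (x∈xs , x∈ys) → separated (All.lookup pxs x∈xs) (All.lookup qys x∈ys)

Unique-⊆⇒length≤ : ∀ {A : Set} {xs ys : List A} → Unique xs → xs ⊆ ys → length xs ≤ length ys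
Unique-⊆⇒length≤ {xs = []} _ _ = z≤n
Unique-⊆⇒length≤ {xs = x ∷ xs} (x∉xs ∷ uxs) x∷xs⊆ys with ∈-∃++ (x∷xs⊆ys (here refl))
... | ys₁ , ys₂ , refl = begin
  suc (length xs)               ≤⟨ s≤s (Unique-⊆⇒length≤ uxs xs⊆ys₁ys₂) ⟩
  suc (length (ys₁ ++ ys₂))     ≡⟨ cong suc (length-++ ys₁) ⟩
  suc (length ys₁ + length ys₂) ≡⟨ +-suc (length ys₁) (length ys₂) ⟨
  length ys₁ + length (x ∷ ys₂) ≡⟨ length-++ ys₁ ⟨
  length (ys₁ ++ x ∷ ys₂)       ∎
  where
  open ≤-Reasoning
  xs⊆ys₁ys₂ : xs ⊆ ys₁ ++ ys₂
  xs⊆ys₁ys₂ z∈xs with ∈-++⁻ ys₁ (x∷xs⊆ys (there z∈xs))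
  ... | inj₁ z∈ys₁ = ∈-++⁺ˡ z∈ys₁
  ... | inj₂ (here refl) = ⊥-elim (All.lookup x∉xs z∈xs refl)
  ... | inj₂ (there z∈ys₂) = ∈-++⁺ʳ ys₁ z∈ys₂

AllPairs-lookup : ∀ {A : Set} {R : A → A → Set} {xs : List A} → Symmetric R → AllPairs R xs →
                  ∀ {i j} → i ≢ j → R (lookup xs i) (lookup xs j)
AllPairs-lookup R-sym (_ ∷ _) {zero} {zero} i≢j = ⊥-elim (i≢j refl)
AllPairs-lookup R-sym (Rx ∷ _) {zero} {suc j} _ = All.lookup Rx (∈-lookup j)
AllPairs-lookup R-sym (Rx ∷ _) {suc i} {zero} _ = R-sym (All.lookup Rx (∈-lookup i))
AllPairs-lookup R-sym (_ ∷ Rxs) {suc i} {suc j} i≢j = AllPairs-lookup R-sym Rxs (i≢j ∘ cong suc)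

toList-proj₁ : ∀ {A : Set} {P : Pred A 0ℓ} {xs} (pxs : All P xs) → map proj₁ (All.toList pxs) ≡ xs
toList-proj₁ [] = refl
toList-proj₁ (_ ∷ pxs) = cong (_ ∷_) (toList-proj₁ pxs)

¬SameSet-sym : Symmetric (λ xs ys → ¬ SameSet xs ys)
¬SameSet-sym xs≉ys ys≈xs = xs≉ys (⇔.sym ∘ ys≈xs)

¬SameSet⇒difference : ¬ SameSet xs ys → (∃ λ x → x ∈ xs × x ∉ ys) ⊎ (∃ λ x → x ∈ ys × x ∉ xs)
¬SameSet⇒difference {xs} {ys} xs≉ys with All.all? (_∈? ys) xs | All.all? (_∈? xs) ys
... | no xs⊈ys | _ = inj₁ (find (Allₚ.¬All⇒Any¬ (_∈? ys) xs xs⊈ys))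
... | yes _ | no ys⊈xs = inj₂ (find (Allₚ.¬All⇒Any¬ (_∈? xs) ys ys⊈xs))
... | yes xs⊆ys | yes ys⊆xs = ⊥-elim (xs≉ys λ _ → mk⇔ (All.lookup xs⊆ys) (All.lookup ys⊆xs))

-- Hamming distance

AtMost-mono : ∀ {P Q : Pred ℕ 0ℓ} → (∀ {z} → P z → Q z) → AtMost Q r → AtMost P r
AtMost-mono P⇒Q atMost zs uzs pzs = atMost zs uzs (All.map P⇒Q pzs)

AtMost-split : ∀ {P Q : Pred ℕ 0ℓ} (P? : Decidable P) →
               AtMost (Q ∩ P) r → AtMost (Q ∩ ∁ P) r′ → AtMost Q (r + r′)
AtMost-split {r = r} {r′} P? atMost atMost′ zs uzs qzs = begin
  length zs                                           ≡⟨ length-filter-∁ P? zs ⟨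
  length (filter P? zs) + length (filter (∁? P?) zs) ≤⟨ +-mono-≤ (atMost _ (unique P?) (both P?))
                                                                 (atMost′ _ (unique (∁? P?)) (both (∁? P?))) ⟩
  r + r′                                              ∎
  where
  open ≤-Reasoning
  unique : ∀ {R} (R? : Decidable R) → Unique (filter R? zs)
  unique R? = Uniqueₚ.filter⁺ R? uzs
  both : ∀ {R} (R? : Decidable R) → All (_ ∩ R) (filter R? zs)
  both R? = All.zip (Allₚ.filter⁺ R? qzs , Allₚ.all-filter R? zs)

DistLE-refl : (a : Seq n) → DistLE a a r
DistLE-refl a [] _ _ = z≤n
DistLE-refl a (_ ∷ _) _ (a≢a ∷ _) = ⊥-elim (a≢a refl)

DistLE-sym : DistLE a b r → DistLE b a r
DistLE-sym a-b zs uzs b≢a = a-b zs uzs (All.map (_∘ sym) b≢a)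

DistLE-trans : ∀ {c} → DistLE a b r → DistLE b c r′ → DistLE a c (r + r′)
DistLE-trans {a = a} {b = b} {r = r} {r′ = r′} {c = c} a-b b-c =
  subst (DistLE a c) (+-comm r′ r)
    (AtMost-split (λ z → a z Finₚ.≟ b z)
      (AtMost-mono (λ (a≢c , a≡b) b≡c → a≢c (trans a≡b b≡c)) b-c)
      (AtMost-mono proj₂ a-b))

DistLE-injection : DistLE a b r → (f : Fin q → ℕ) → (∀ {g h} → f g ≡ f h → g ≡ h) →
                   (∀ g → a (f g) ≢ b (f g)) → q ≤ r
DistLE-injection a-b f f-injective a≢b =
  subst (_≤ _) (length-tabulate f) (a-b (tabulate f) (Uniqueₚ.tabulate⁺ f-injective) (Allₚ.tabulate⁺ a≢b))

DistLE-Seq₁ : (a b : Seq 1) → DistLE a b r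
DistLE-Seq₁ a b [] _ _ = z≤n
DistLE-Seq₁ a b (z ∷ _) _ (a≢b ∷ _) with a z | b z
... | zero | zero = ⊥-elim (a≢b refl)

opaque
  splice : List ℕ → Seq n → Seq n → Seq n
  splice D b a z with z ∈? D
  ... | yes _ = b z
  ... | no _ = a z

  splice-∈ : z ∈ D → splice D b a z ≡ b z
  splice-∈ {z = z} {D} z∈D with z ∈? D
  ... | yes _ = refl
  ... | no z∉D = contradiction z∈D z∉D

  splice-∉ : z ∉ D → splice D b a z ≡ a z
  splice-∉ {z = z} {D} z∉D with z ∈? D
  ... | yes z∈D = contradiction z∈D z∉D
  ... | no _ = refl

  splice-≡ : ∀ {v : Fin n} → b z ≡ v → a z ≡ v → splice D b a z ≡ v
  splice-≡ {z = z} {D = D} bz≡v az≡v with z ∈? D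
  ... | yes _ = bz≡v
  ... | no _ = az≡v

DistLE-splice : DistLE a (splice D b a) (length D)
DistLE-splice {a = a} {D = D} {b = b} zs uzs a≢splice =
  Unique-⊆⇒length≤ uzs λ {z} z∈zs → inside z (All.lookup a≢splice z∈zs)
  where
  inside : ∀ z → a z ≢ splice D b a z → z ∈ D
  inside z a≢splice with z ∈? D
  ... | yes z∈D = z∈D
  ... | no z∉D = contradiction (sym (splice-∉ z∉D)) a≢splice

BallSub-splice : BallSub a ℓ (splice D b a) (length D + ℓ)
BallSub-splice {D = D} {b = b} y a-y = DistLE-trans (DistLE-sym (DistLE-splice {D = D} {b = b})) a-y

DiamLE : Subset n → ℕ → Set
DiamLE S d = ∀ a b → S a → S b → DistLE a b d

Maximal⇒DiamLE : Maximal S d → DiamLE S d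
Maximal⇒DiamLE ((diam , _) , _) = diam

maximal-closed : ∀ {n} {S : Subset n} {x} → Maximal S d → (∀ s → S s → DistLE x s d) → S x
maximal-closed {d = d} {n} {S} {x} ((diam , a , b , Sa , Sb , a-b) , maximal) x-close =
  maximal S∪x (λ _ → inj₁) (diam′ , a , b , inj₁ Sa , inj₁ Sb , a-b) x (inj₂ refl)
  where
  S∪x : Subset n
  S∪x y = S y ⊎ y ≡ x
  diam′ : DiamLE S∪x d
  diam′ a b (inj₁ Sa) (inj₁ Sb) = diam a b Sa Sb
  diam′ a _ (inj₁ Sa) (inj₂ refl) = DistLE-sym (x-close a Sa)
  diam′ _ b (inj₂ refl) (inj₁ Sb) = x-close b Sb
  diam′ _ _ (inj₂ refl) (inj₂ refl) = DistLE-refl x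

-- Move a away from s on ℓ fresh positions: the result stays in the ball, hence in S.
ball-margin : ∀ {n′} {S : Subset (2 + n′)} {a s} → DiamLE S d → BallIn a ℓ S → S s →
              Unique zs → All (λ z → a z ≢ s z) zs → length zs + ℓ ≤ d
ball-margin {d = d} {ℓ = ℓ} {zs = zs} {n′} {a = a} {s} diam ball Ss uzs a≢s = begin
  length zs + ℓ            ≡⟨ cong (length zs +_) length-fresh ⟨
  length zs + length fresh ≡⟨ length-++ zs ⟨
  length (zs ++ fresh)     ≤⟨ diam y s (ball y a-y) Ss (zs ++ fresh) unique y≢s ⟩
  d                        ∎
  where
  open ≤-Reasoning
  B : ℕ
  B = suc (max 0 zs)
  fresh : List ℕ
  fresh = map (B +_) (upTo ℓ)
  length-fresh : length fresh ≡ ℓ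
  length-fresh = trans (length-map _ (upTo ℓ)) (length-upTo ℓ)
  fresh-large : ∀ {z} → z ∈ fresh → B ≤ z
  fresh-large z∈fresh with ∈-map⁻ (B +_) z∈fresh
  ... | i , _ , refl = m≤m+n B i
  zs-small : ∀ {z} → z ∈ zs → z < B
  zs-small z∈zs = s≤s (All.lookup (xs≤max 0 zs) z∈zs)
  y : Seq (2 + n′)
  y = splice fresh (λ z → punchIn (s z) zero) a
  a-y : DistLE a y ℓ
  a-y = subst (DistLE a y) length-fresh (DistLE-splice {D = fresh})
  unique : Unique (zs ++ fresh)
  unique = Unique-++⁺ uzs (Uniqueₚ.map⁺ (+-cancelˡ-≡ B _ _) (Uniqueₚ.upTo⁺ ℓ))
                      (All.tabulate zs-small) (All.tabulate fresh-large) <⇒≱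
  y≢s : All (λ z → y z ≢ s z) (zs ++ fresh)
  y≢s = Allₚ.++⁺
    (All.tabulate λ {z} z∈zs →
      subst (_≢ s z) (sym (splice-∉ λ z∈fresh → <⇒≱ (zs-small z∈zs) (fresh-large z∈fresh)))
            (All.lookup a≢s z∈zs))
    (All.tabulate λ {z} z∈fresh →
      subst (_≢ s z) (sym (splice-∈ {a = a} z∈fresh)) (Finₚ.punchInᵢ≢i (s z) zero))

free? : (t : Template n) → Decidable (λ z → t z ≡ nothing)
free? t z with t z
... | just _ = no λ ()
... | nothing = yes refl

¬free⇒fixed : (t : Template n) → ¬ t z ≡ nothing → ∃ λ v → t z ≡ just v
¬free⇒fixed {z = z} t not-free with t z
... | just v = v , refl
... | nothing = contradiction refl not-free

record FreeSupport (w : Seq n) (t : Template n) (a : Seq n) (F : List ℕ) : Set where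
  field
    unique   : Unique F
    sound    : ∀ {z} → z ∈ F → t z ≡ nothing × w z ≢ a z
    complete : ∀ {z} → t z ≡ nothing → w z ≢ a z → z ∈ F

  outside : ∀ {z} → t z ≡ nothing → z ∉ F → a z ≡ w z
  outside {z} free z∉F with w z Finₚ.≟ a z
  ... | yes w≡a = sym w≡a
  ... | no w≢a = contradiction (complete free w≢a) z∉F

open FreeSupport

free-support : ∀ {t : Template n} {m k} → Regular t w → Weight t m → DistEq w a k → Fits a t →
               Σ (List ℕ) λ F → FreeSupport w t a F × m + length F ≡ k
free-support {w = w} {a = a} {t = t} {m} {k} regular (fixed≤m , ts , uts , ts-fixed , |ts|≡m)
             (w-a≤k , zs , uzs , w≢a , |zs|≡k) fits = F , support , ≤-antisym upper lower
  where
  open ≤-Reasoning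
  F : List ℕ
  F = filter (free? t) zs

  listed : ∀ {z} → w z ≢ a z → z ∈ zs
  listed {z} w≢az with z ∈? zs
  ... | yes z∈zs = z∈zs
  ... | no z∉zs = ⊥-elim (1+n≰n (subst (λ l → suc l ≤ k) |zs|≡k
                    (w-a≤k (z ∷ zs) (Allₚ.¬Any⇒All¬ zs z∉zs ∷ uzs) (w≢az ∷ w≢a))))

  support : FreeSupport w t a F
  support = record
    { unique   = Uniqueₚ.filter⁺ (free? t) uzs
    ; sound    = λ z∈F → let (z∈zs , free) = ∈-filter⁻ (free? t) z∈F in free , All.lookup w≢a z∈zs
    ; complete = λ free w≢az → ∈-filter⁺ (free? t) (listed w≢az) free
    }

  fixed⇒w≢a : ∀ {z} → (∃ λ v → t z ≡ just v) → w z ≢ a z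
  fixed⇒w≢a {z} (v , tz) w≡a = regular z v tz (trans (sym (fits z v tz)) (sym w≡a))

  upper : m + length F ≤ k
  upper = begin
    m + length F         ≡⟨ cong (_+ length F) |ts|≡m ⟨
    length ts + length F ≡⟨ length-++ ts ⟨
    length (ts ++ F)     ≤⟨ w-a≤k (ts ++ F)
                              (Unique-++⁺ uts (unique support) ts-fixed (Allₚ.all-filter (free? t) zs)
                                 λ (v , tz) tz′ → contradiction (trans (sym tz) tz′) λ ())
                              (Allₚ.++⁺ (All.map fixed⇒w≢a ts-fixed) (All.tabulate (proj₂ ∘ sound support))) ⟩
    k                    ∎

  lower : k ≤ m + length F
  lower = begin
    k                                                       ≡⟨ |zs|≡k ⟨
    length zs                                               ≡⟨ length-filter-∁ (free? t) zs ⟨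
    length F + length (filter (∁? (free? t)) zs)            ≤⟨ +-monoʳ-≤ (length F) fixed-count ⟩
    length F + m                                            ≡⟨ +-comm (length F) m ⟩
    m + length F                                            ∎
    where
    fixed-count : length (filter (∁? (free? t)) zs) ≤ m
    fixed-count = fixed≤m _ (Uniqueₚ.filter⁺ (∁? (free? t)) uzs)
                    (All.map (¬free⇒fixed t) (Allₚ.all-filter (∁? (free? t)) zs))

-- Footprints

-- The paper's set {(z, ⋆), (z, a z) : z ∈ F}, with the pairs coded injectively by natural numbers.
module Footprint (n : ℕ) where

  opaque
    encode : ℕ → Fin (suc n) → ℕ
    encode z v = toℕ v + z * suc n

    encode-injective : ∀ {z z′ v v′} → encode z v ≡ encode z′ v′ → z ≡ z′ × v ≡ v′
    encode-injective {z} {z′} {v} {v′} eq = z≡z′ , Finₚ.toℕ-injective v≡v′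
      where
      digit : ∀ z v → encode z v % suc n ≡ toℕ v
      digit z v = trans ([m+kn]%n≡m%n (toℕ v) z (suc n)) (m<n⇒m%n≡m (Finₚ.toℕ<n v))
      v≡v′ : toℕ v ≡ toℕ v′
      v≡v′ = trans (sym (digit z v)) (trans (cong (_% suc n) eq) (digit z′ v′))
      z≡z′ : z ≡ z′
      z≡z′ = *-cancelʳ-≡ z z′ (suc n) (+-cancelˡ-≡ (toℕ v) _ _ (trans eq (cong (_+ z′ * suc n) (sym v≡v′))))

  mark : ℕ → ℕ
  mark z = encode z zero

  entry : ℕ → Fin n → ℕ
  entry z v = encode z (suc v)

  opaque
    footprint : Seq n → List ℕ → List ℕ
    footprint a F = map mark F ++ map (λ z → entry z (a z)) F

    mark∈ : ∀ {a F} → z ∈ F → mark z ∈ footprint a F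
    mark∈ z∈F = ∈-++⁺ˡ (∈-map⁺ mark z∈F)

    entry∈ : ∀ {a F} → z ∈ F → entry z (a z) ∈ footprint a F
    entry∈ {F = F} z∈F = ∈-++⁺ʳ (map mark F) (∈-map⁺ _ z∈F)

    footprint⁻ : ∀ {x a F} → x ∈ footprint a F → ∃ λ z → z ∈ F × (x ≡ mark z ⊎ x ≡ entry z (a z))
    footprint⁻ {F = F} x∈ with ∈-++⁻ (map mark F) x∈
    ... | inj₁ x∈marks   = let (z , z∈F , x≡) = ∈-map⁻ mark x∈marks in z , z∈F , inj₁ x≡
    ... | inj₂ x∈entries = let (z , z∈F , x≡) = ∈-map⁻ _ x∈entries in z , z∈F , inj₂ x≡

    footprint-unique : ∀ {a F} → Unique F → Unique (footprint a F)
    footprint-unique {a} {F} uF =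
      Uniqueₚ.++⁺ (Uniqueₚ.map⁺ (proj₁ ∘ encode-injective) uF)
                  (Uniqueₚ.map⁺ (proj₁ ∘ encode-injective) uF) disjoint
      where
      disjoint : ∀ {x} → ¬ (x ∈ map mark F × x ∈ map (λ z → entry z (a z)) F)
      disjoint (x∈marks , x∈entries) with ∈-map⁻ mark x∈marks | ∈-map⁻ _ x∈entries
      ... | _ , _ , refl | _ , _ , eq = contradiction (proj₂ (encode-injective eq)) λ ()

    length-footprint : ∀ {a F} → length (footprint a F) ≡ length F + length F
    length-footprint {F = F} =
      trans (length-++ (map mark F)) (cong₂ _+_ (length-map mark F) (length-map _ F))

  mark∈⁻ : ∀ {a F} → mark z ∈ footprint a F → z ∈ F
  mark∈⁻ {F = F} m∈ with footprint⁻ m∈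
  ... | _ , z′∈F , inj₁ eq = subst (_∈ F) (sym (proj₁ (encode-injective eq))) z′∈F
  ... | _ , _ , inj₂ eq = contradiction (proj₂ (encode-injective eq)) λ ()

  entry∈⁻ : ∀ {v a F} → entry z v ∈ footprint a F → z ∈ F × a z ≡ v
  entry∈⁻ e∈ with footprint⁻ e∈
  ... | _ , _ , inj₁ eq = contradiction (proj₂ (encode-injective eq)) λ ()
  ... | _ , z′∈F , inj₂ eq with encode-injective eq
  ...   | refl , refl = z′∈F , refl

  footprint-determines : ∀ {t : Template n} {F G} → Fits a t → Fits b t →
                         FreeSupport w t a F → FreeSupport w t b G →
                         SameSet (footprint a F) (footprint b G) → ∀ z → a z ≡ b z
  footprint-determines {t = t} {F} {G} a-fits b-fits a-support b-support same z with t z in tz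
  ... | just v = trans (a-fits z v tz) (sym (b-fits z v tz))
  ... | nothing with z ∈? F | z ∈? G
  ...   | yes z∈F | _       = sym (proj₂ (entry∈⁻ (Equivalence.to (same _) (entry∈ z∈F))))
  ...   | no _    | yes z∈G = proj₂ (entry∈⁻ (Equivalence.from (same _) (entry∈ z∈G)))
  ...   | no z∉F  | no z∉G  = trans (outside a-support tz z∉F) (sym (outside b-support tz z∉G))

-- Sunflowers

Meets : List ℕ → List ℕ → List ℕ → Set
Meets core xs ys = ∀ x → (x ∈ xs × x ∈ ys) ⇔ (x ∈ core)

Meets-sym : ∀ {core} → Symmetric (Meets core)
Meets-sym xs∩ys x = mk⇔ (Equivalence.to (xs∩ys x) ∘ swap) (swap ∘ Equivalence.from (xs∩ys x))

module CardinalityBound {n′ : ℕ} {S : Subset (2 + n′)} {d : ℕ} (maximal : Maximal S d)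
  {w : Seq (2 + n′)} {ℓ m k : ℕ} {t : Template (2 + n′)} (regular : Regular t w) (weight : Weight t m) where

  open Footprint (2 + n′)

  Point : Set
  Point = ∃ (Restrict (Sk (Sℓ S ℓ) w k) t)

  support-of : (p : Point) → Σ (List ℕ) λ F → FreeSupport w t (proj₁ p) F × m + length F ≡ k
  support-of (_ , (_ , dist) , fits) = free-support regular weight dist fits

  free : Point → List ℕ
  free p = proj₁ (support-of p)

  code : Point → List ℕ
  code p = footprint (proj₁ p) (free p)

  length-code : ∀ p → length (code p) ≡ 2 * k ∸ 2 * m
  length-code p = begin
    length (code p)         ≡⟨ length-footprint ⟩
    l + l                   ≡⟨ cong (l +_) (+-identityʳ l) ⟨
    2 * l                   ≡⟨ cong (2 *_) (m+n∸m≡n m l) ⟨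
    2 * (m + l ∸ m)         ≡⟨ cong (λ k′ → 2 * (k′ ∸ m)) (proj₂ (proj₂ (support-of p))) ⟩
    2 * (k ∸ m)             ≡⟨ *-distribˡ-∸ 2 k m ⟩
    2 * k ∸ 2 * m           ∎
    where
    open ≡-Reasoning
    l : ℕ
    l = length (free p)

  code-determines : ∀ p q → SameSet (code p) (code q) → ∀ z → proj₁ p z ≡ proj₁ q z
  code-determines p q = footprint-determines (proj₂ (proj₂ p)) (proj₂ (proj₂ q))
                          (proj₁ (proj₂ (support-of p))) (proj₁ (proj₂ (support-of q)))

  module Petals (petal : Fin (2 + n′ + d) → Point) (core : List ℕ)
    (meets : ∀ {g h} → g ≢ h → Meets core (code (petal g)) (code (petal h)))
    (distinct : ∀ {g h} → g ≢ h → ¬ SameSet (code (petal g)) (code (petal h)))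
    where

    private variable
      g h : Fin (2 + n′ + d)

    A : Fin (2 + n′ + d) → Seq (2 + n′)
    A g = proj₁ (petal g)

    F : Fin (2 + n′ + d) → List ℕ
    F g = free (petal g)

    support : ∀ g → FreeSupport w t (A g) (F g)
    support g = proj₁ (proj₂ (support-of (petal g)))

    A∈Sℓ : ∀ g → Sℓ S ℓ (A g)
    A∈Sℓ g = proj₁ (proj₁ (proj₂ (petal g)))

    fits : ∀ g → Fits (A g) t
    fits g = proj₂ (proj₂ (petal g))

    same-size : ∀ g h → length (F g) ≡ length (F h)
    same-size g h = +-cancelˡ-≡ m _ _ (trans (proj₂ (proj₂ (support-of (petal g))))
                                             (sym (proj₂ (proj₂ (support-of (petal h))))))

    meet⊆core : ∀ {x} → g ≢ h → x ∈ code (petal g) → x ∈ code (petal h) → x ∈ core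
    meet⊆core g≢h x∈g x∈h = Equivalence.to (meets g≢h _) (x∈g , x∈h)

    core⊆petal : ∀ g {x} → x ∈ core → x ∈ code (petal g)
    core⊆petal g x∈core = proj₁ (Equivalence.from (meets (Finₚ.punchInᵢ≢i g zero ∘ sym) _) x∈core)

    Core : Pred ℕ 0ℓ
    Core z = mark z ∈ core

    core? : Decidable Core
    core? z = mark z ∈? core

    Private : Fin (2 + n′ + d) → Pred ℕ 0ℓ
    Private g z = z ∈ F g × ¬ Core z

    private? : ∀ g → Decidable (Private g)
    private? g z = (z ∈? F g) ×-dec ¬? (core? z)

    core-positions private-positions : Fin (2 + n′ + d) → List ℕ
    core-positions g = filter core? (F g)
    private-positions g = filter (∁? core?) (F g)

    private-positions⁺ : Private g z → z ∈ private-positions g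
    private-positions⁺ (z∈F , ¬core) = ∈-filter⁺ (∁? core?) z∈F ¬core

    private-positions⁻ : z ∈ private-positions g → Private g z
    private-positions⁻ = ∈-filter⁻ (∁? core?)

    core⇒free : Core z → ∀ g → z ∈ F g
    core⇒free z∈core g = mark∈⁻ (core⊆petal g z∈core)

    private⇒elsewhere-w : Private g z → h ≢ g → A h z ≡ w z
    private⇒elsewhere-w {g} {h = h} (z∈Fg , ¬core) h≢g =
      outside (support h) (proj₁ (sound (support g) z∈Fg))
        λ z∈Fh → ¬core (meet⊆core (h≢g ∘ sym) (mark∈ z∈Fg) (mark∈ z∈Fh))

    private⇒off-w : Private g z → w z ≢ A g z
    private⇒off-w {g} (z∈Fg , _) = proj₂ (sound (support g) z∈Fg)

    private-unique : Private g z → Private h z → g ≡ h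
    private-unique {g} {h = h} pg ph with g Finₚ.≟ h
    ... | yes g≡h = g≡h
    ... | no g≢h = contradiction (private⇒elsewhere-w pg (g≢h ∘ sym)) (private⇒off-w ph ∘ sym)

    -- The n + d letters A g z all differ from w z, so two of them coincide; that entry then lies in the core.
    core⇒agree : Core z → ∀ g h → A g z ≡ A h z
    core⇒agree {z} z∈core = agree (Finₚ.pigeonhole (s≤s (s≤s (m≤m+n n′ d))) (λ g → punchOut (off-w g)))
      where
      off-w : ∀ g → w z ≢ A g z
      off-w g = proj₂ (sound (support g) (core⇒free z∈core g))
      agree : (∃₂ λ g₁ g₂ → g₁ Fin.< g₂ × punchOut (off-w g₁) ≡ punchOut (off-w g₂)) →
              ∀ g h → A g z ≡ A h z
      agree (g₁ , g₂ , g₁<g₂ , same-slot) g h = trans (from-core g) (sym (from-core h))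
        where
        shared : entry z (A g₁ z) ∈ core
        shared = meet⊆core (Finₚ.<⇒≢ g₁<g₂) (entry∈ (core⇒free z∈core g₁))
                   (subst (λ v → entry z v ∈ code (petal g₂))
                          (Finₚ.punchOut-injective (off-w g₂) (off-w g₁) (sym same-slot))
                          (entry∈ (core⇒free z∈core g₂)))
        from-core : ∀ g → A g z ≡ A g₁ z
        from-core g = proj₂ (entry∈⁻ (core⊆petal g shared))

    agree-off-private : ¬ Private g z → ¬ Private h z → A g z ≡ A h z
    agree-off-private {g} {z} {h} ¬pg ¬ph with t z in tz | core? z
    ... | just v  | _          = trans (fits g z v tz) (sym (fits h z v tz))
    ... | nothing | yes z∈core = core⇒agree z∈core g h
    ... | nothing | no ¬core   = trans (outside (support g) tz (λ z∈F → ¬pg (z∈F , ¬core)))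
                                       (sym (outside (support h) tz (λ z∈F → ¬ph (z∈F , ¬core))))

    private-in-difference : ∀ {x} → x ∈ code (petal g) → x ∉ code (petal h) → Σ ℕ (Private g)
    private-in-difference {g} {h} {x} x∈g x∉h with footprint⁻ x∈g
    ... | z , z∈F , x-code with core? z
    ...   | no ¬core   = z , z∈F , ¬core
    ...   | yes z∈core = contradiction (in-h x-code) x∉h
      where
      in-h : x ≡ mark z ⊎ x ≡ entry z (A g z) → x ∈ code (petal h)
      in-h (inj₁ x≡mark) = subst (_∈ _) (sym x≡mark) (core⊆petal h z∈core)
      in-h (inj₂ x≡entry) = subst (_∈ _) (trans (cong (entry z) (core⇒agree z∈core h g)) (sym x≡entry))
                                  (entry∈ (core⇒free z∈core h))

    some-private : ∃ λ i → Σ ℕ (Private i)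
    some-private with ¬SameSet⇒difference (distinct {zero} {suc zero} λ ())
    ... | inj₁ (_ , x∈₀ , x∉₁) = zero , private-in-difference x∈₀ x∉₁
    ... | inj₂ (_ , x∈₁ , x∉₀) = suc zero , private-in-difference x∈₁ x∉₀

    -- Otherwise s would differ from A i on one private position of each of the other n + d − 1 > d petals.
    untouched : S s → ∀ i → ∃ λ h → h ≢ i × (∀ {z} → Private h z → s z ≡ w z)
    untouched {s} Ss i
      with Finₚ.any? (λ h → ¬? (h Finₚ.≟ i) ×-dec All.all? (λ z → s z Finₚ.≟ w z) (private-positions h))
    ... | yes (h , h≢i , s≡w) = h , h≢i , All.lookup s≡w ∘ private-positions⁺
    ... | no none = contradiction (DistLE-injection s-aᵢ moved moved-injective s≢aᵢ) (≤⇒≯ (m≤n+m d n′))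
      where
      s-aᵢ : DistLE s (A i) d
      s-aᵢ = Maximal⇒DiamLE maximal s (A i) Ss (proj₁ (A∈Sℓ i))
      touched : ∀ g → ∃ λ z → z ∈ private-positions (punchIn i g) × s z ≢ w z
      touched g = find (Allₚ.¬All⇒Any¬ (λ z → s z Finₚ.≟ w z) _
                          λ s≡w → none (_ , Finₚ.punchInᵢ≢i i g , s≡w))
      moved : Fin (suc (n′ + d)) → ℕ
      moved g = proj₁ (touched g)
      moved-private : ∀ g → Private (punchIn i g) (moved g)
      moved-private g = private-positions⁻ (proj₁ (proj₂ (touched g)))
      moved-injective : ∀ {g g′} → moved g ≡ moved g′ → g ≡ g′
      moved-injective {g} {g′} eq = Finₚ.punchIn-injective i g g′
        (private-unique (moved-private g) (subst (Private _) (sym eq) (moved-private g′)))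
      s≢aᵢ : ∀ g → s (moved g) ≢ A i (moved g)
      s≢aᵢ g s≡aᵢ = proj₂ (proj₂ (touched g))
                      (trans s≡aᵢ (private⇒elsewhere-w (moved-private g) (Finₚ.punchInᵢ≢i i g ∘ sym)))

    same-core-count : ∀ g h → length (core-positions g) ≡ length (core-positions h)
    same-core-count g h = ≤-antisym (core-count≤ g h) (core-count≤ h g)
      where
      core-count≤ : ∀ g h → length (core-positions g) ≤ length (core-positions h)
      core-count≤ g h = Unique-⊆⇒length≤ (Uniqueₚ.filter⁺ core? (unique (support g))) λ z∈ →
        let (_ , z∈core) = ∈-filter⁻ core? {xs = F g} z∈ in ∈-filter⁺ core? (core⇒free z∈core h) z∈core

    same-private-count : ∀ g h → length (private-positions g) ≡ length (private-positions h)
    same-private-count g h = +-cancelˡ-≡ (length (core-positions g)) _ _ (begin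
      length (core-positions g) + length (private-positions g) ≡⟨ length-filter-∁ core? (F g) ⟩
      length (F g)                                             ≡⟨ same-size g h ⟩
      length (F h)                                             ≡⟨ length-filter-∁ core? (F h) ⟨
      length (core-positions h) + length (private-positions h) ≡⟨ cong (_+ _) (same-core-count h g) ⟩
      length (core-positions g) + length (private-positions h) ∎)
      where open ≡-Reasoning

    module Reset (i : Fin (2 + n′ + d)) (j : ℕ) (j-private : Private i j) where

      c : Seq (2 + n′)
      c = splice [ j ] w (A i)

      c-at-w : A i z ≡ w z → c z ≡ w z
      c-at-w = splice-≡ refl

      c-at-j : c j ≡ w j
      c-at-j = splice-∈ (here refl)

      c-off-j : z ≢ j → c z ≡ A i z
      c-off-j z≢j = splice-∉ λ { (here z≡j) → z≢j z≡j }

      -- Positions z where c differs from s split into those that are private to i with s z = w z,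
      -- which together with j lie among the private positions of i, and the rest, which together
      -- with the private positions of h separate A h from s.
      module Against {s} (Ss : S s) (h : Fin (2 + n′ + d)) (h≢i : h ≢ i)
                     (s≡w : ∀ {z} → Private h z → s z ≡ w z) where

        Returned : Pred ℕ 0ℓ
        Returned z = Private i z × s z ≡ w z

        returned? : Decidable Returned
        returned? z = private? i z ×-dec (s z Finₚ.≟ w z)

        returned≢j : c z ≢ s z → Returned z → j ≢ z
        returned≢j c≢s (_ , s≡w) j≡z = c≢s (trans (subst (λ y → c y ≡ w y) j≡z c-at-j) (sym s≡w))

        returned-count : Unique zs → All (λ z → c z ≢ s z) zs →
                         suc (length (filter returned? zs)) ≤ length (private-positions i)
        returned-count {zs} uzs c≢s =
          Unique-⊆⇒length≤ (j∉returned ∷ Uniqueₚ.filter⁺ returned? uzs) λ where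
            (here refl) → private-positions⁺ j-private
            (there z∈)  → private-positions⁺ (proj₁ (proj₂ (∈-filter⁻ returned? {xs = zs} z∈)))
          where
          j∉returned : All (j ≢_) (filter returned? zs)
          j∉returned = All.zipWith (λ (c≢s , returned) → returned≢j c≢s returned)
                         (Allₚ.filter⁺ returned? c≢s , Allₚ.all-filter returned? zs)

        rival : c z ≢ s z → ¬ Returned z → ¬ Private h z × A h z ≢ s z
        rival {z} c≢s ¬returned = ¬ph , ah≢s
          where
          ¬ph : ¬ Private h z
          ¬ph ph = c≢s (trans (c-at-w (private⇒elsewhere-w ph (h≢i ∘ sym))) (sym (s≡w ph)))
          ah≢s : A h z ≢ s z
          ah≢s with private? i z
          ... | yes pi = λ ah≡s → ¬returned (pi , trans (sym ah≡s) (private⇒elsewhere-w pi h≢i))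
          ... | no ¬pi = λ ah≡s → c≢s (trans (c-off-j λ z≡j → ¬pi (subst (Private i) (sym z≡j) j-private))
                                            (trans (agree-off-private ¬pi ¬ph) ah≡s))

        rest-count : Unique zs → All (λ z → c z ≢ s z) zs →
                     length (filter (∁? returned?) zs) + length (private-positions h) + ℓ ≤ d
        rest-count {zs} uzs c≢s = subst (λ l → l + ℓ ≤ d) (length-++ rest)
          (ball-margin (Maximal⇒DiamLE maximal) (proj₁ (proj₂ (A∈Sℓ h))) Ss separating
             (Allₚ.++⁺ (All.map proj₂ rest-rival) private-rival))
          where
          rest : List ℕ
          rest = filter (∁? returned?) zs
          rest-rival : All (λ z → ¬ Private h z × A h z ≢ s z) rest
          rest-rival = All.zipWith (λ (c≢s , ¬returned) → rival c≢s ¬returned)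
                         (Allₚ.filter⁺ (∁? returned?) c≢s , Allₚ.all-filter (∁? returned?) zs)
          private-rival : All (λ z → A h z ≢ s z) (private-positions h)
          private-rival = All.tabulate λ z∈ ah≡s →
            let ph = private-positions⁻ z∈ in private⇒off-w ph (trans (sym (s≡w ph)) (sym ah≡s))
          separating : Unique (rest ++ private-positions h)
          separating = Unique-++⁺ (Uniqueₚ.filter⁺ (∁? returned?) uzs)
                                  (Uniqueₚ.filter⁺ (∁? core?) (unique (support h)))
                                  (All.map proj₁ rest-rival) (All.tabulate private-positions⁻) λ ¬ph ph → ¬ph ph

      margin : S s → Unique zs → All (λ z → c z ≢ s z) zs → length zs + suc ℓ ≤ d
      margin {s} {zs} Ss uzs c≢s with untouched Ss i
      ... | h , h≢i , s≡w = begin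
        length zs + suc ℓ                 ≡⟨ cong (_+ suc ℓ) (length-filter-∁ returned? zs) ⟨
        (|R| + |rest|) + suc ℓ             ≡⟨ +-suc (|R| + |rest|) ℓ ⟩
        (suc |R| + |rest|) + ℓ             ≤⟨ +-monoˡ-≤ ℓ (+-monoˡ-≤ |rest| (returned-count uzs c≢s)) ⟩
        (#private i + |rest|) + ℓ         ≡⟨ cong (λ l → (l + |rest|) + ℓ) (same-private-count i h) ⟩
        (#private h + |rest|) + ℓ         ≡⟨ cong (_+ ℓ) (+-comm (#private h) |rest|) ⟩
        (|rest| + #private h) + ℓ         ≤⟨ rest-count uzs c≢s ⟩
        d                                 ∎
        where
        open ≤-Reasoning
        open Against Ss h h≢i s≡w
        |R| |rest| : ℕ
        |R| = length (filter returned? zs)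
        |rest| = length (filter (∁? returned?) zs)
        #private : Fin (2 + n′ + d) → ℕ
        #private g = length (private-positions g)

      ball-in-S : BallIn c (suc ℓ) S
      ball-in-S x c-x = maximal-closed maximal λ s Ss →
        subst (DistLE x s) (m+[n∸m]≡n (margin Ss [] []))
          (DistLE-trans (DistLE-sym c-x) λ zs uzs c≢s → m+n≤o⇒m≤o∸n (length zs) (margin Ss uzs c≢s))

      absurd : ⊥
      absurd = proj₂ (proj₂ (A∈Sℓ i)) (c , BallSub-splice {D = [ j ]} , ball-in-S)

    absurd : ⊥
    absurd = let (i , j , j-private) = some-private in Reset.absurd i j j-private

  no-large-sunflower : (ps : List Point) (Gs : List (List ℕ)) → length Gs ≡ d + (2 + n′) →
                       All (_∈ map code ps) Gs → AllPairs (λ A B → ¬ SameSet A B) Gs → CommonCore Gs → ⊥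
  no-large-sunflower ps Gs |Gs| Gs⊆ Gs-distinct (core , meets) =
    Petals.absurd petal core (on-petals Meets-sym meets) (on-petals ¬SameSet-sym Gs-distinct)
    where
    index : Fin (2 + n′ + d) → Fin (length Gs)
    index = cast (trans (+-comm (2 + n′) d) (sym |Gs|))

    index-injective : ∀ {g h} → index g ≡ index h → g ≡ h
    index-injective {g} {h} eq =
      Finₚ.toℕ-injective (trans (sym (Finₚ.toℕ-cast _ g)) (trans (cong toℕ eq) (Finₚ.toℕ-cast _ h)))

    petal-of : ∀ g → ∃ λ p → p ∈ ps × lookup Gs (index g) ≡ code p
    petal-of g = ∈-map⁻ code (All.lookup Gs⊆ (∈-lookup (index g)))

    petal : Fin (2 + n′ + d) → Point
    petal g = proj₁ (petal-of g)

    on-petals : ∀ {R : List ℕ → List ℕ → Set} → Symmetric R → AllPairs R Gs →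
                ∀ {g h} → g ≢ h → R (code (petal g)) (code (petal h))
    on-petals {R} R-sym pairs {g} {h} g≢h =
      subst₂ R (proj₂ (proj₂ (petal-of g))) (proj₂ (proj₂ (petal-of h)))
        (AllPairs-lookup R-sym pairs (g≢h ∘ index-injective))

  card-bound : ∀ {N} → SunProp (d + (2 + n′)) (2 * k ∸ 2 * m) N → CardLE (Restrict (Sk (Sℓ S ℓ) w k) t) N
  card-bound {N} sunflower xs xs-distinct xs∈X = ≮⇒≥ λ N<|xs| →
    let (Gs , |Gs| , Gs⊆ , Gs-distinct , Gs-core) =
          sunflower codes uniform codes-distinct (subst (N <_) (sym |codes|) N<|xs|)
    in no-large-sunflower ps Gs |Gs| Gs⊆ Gs-distinct Gs-core
    where
    ps : List Point
    ps = All.toList xs∈X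
    codes : List (List ℕ)
    codes = map code ps
    |codes| : length codes ≡ length xs
    |codes| = trans (length-map code ps)
                    (trans (sym (length-map proj₁ ps)) (cong length (toList-proj₁ xs∈X)))
    uniform : All (λ A → Unique A × length A ≡ 2 * k ∸ 2 * m) codes
    uniform = Allₚ.map⁺ (All.universal (λ p → footprint-unique (unique (proj₁ (proj₂ (support-of p))))
                                               , length-code p) ps)
    codes-distinct : AllPairs (λ A B → ¬ SameSet A B) codes
    codes-distinct = AllPairsₚ.map⁺ (AllPairs.map (λ {p} {q} p≉q same → p≉q (code-determines p q same))
                       (AllPairsₚ.map⁻ (subst (AllPairs _) (sym (toList-proj₁ xs∈X)) xs-distinct)))

lemma12 : (n d L : ℕ) → 1 ≤ n → 2 * L ≤ d
    → (S : Subset n) → Maximal S d → ¬ ContainsBall S (suc L)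
    → (w : Seq n) → S w
    → (ℓ m k : ℕ) → m ≤ k
    → (t : Template n) → Regular t w → Weight t m
    → (N : ℕ) → IsSun (d + n) (2 * k ∸ 2 * m) N
    → CardLE (Restrict (Sk (Sℓ S ℓ) w k) t) N
lemma12 zero _ _ ()
-- For n = 1 the space is a single point, so S would contain every ball. This is the only use of the
-- ball hypothesis.
lemma12 (suc zero) _ _ _ _ _ maximal no-ball w _ _ _ _ _ _ _ _ _ _ =
  ⊥-elim (no-ball (w , λ b _ → maximal-closed maximal λ s _ → DistLE-Seq₁ b s))
lemma12 (suc (suc _)) _ _ _ _ _ maximal _ _ _ _ _ _ _ _ regular weight _ (sunflower , _) =
  CardinalityBound.card-bound maximal regular weight sunflower
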